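{- For every integer $d\geq2$ and tree $T$ with $n\geq2$ vertices, the minimum number of degree-$d$ subtrees of $T$ that partition $E(T)$ is at most $$1+\frac{n-2}{d},$$ with equality if and only if $\deg(v)\equiv1\pmod{d}$ for every vertex $v$.
   Context: A partition of a graph is a set of connected subgraphs such that every edge is in exactly one subgraph. A graph is degree-$d$ if its maximum degree is at most $d$. -}

module Defs where

open import Data.Nat using (ℕ; zero; suc; _+_; _*_; _≤_)
open import Data.Fin using (Fin; zero; suc)
open import Data.Bool using (Bool; true; false; if_then_else_)
open import Data.List using (List; []; _∷_; _++_; [_]; length)
open import Data.List.Relation.Unary.Unique.Propositional using (Unique)
open import Data.Product using (Σ; ∃; ∃-syntax; _×_; _,_)
open import Data.Empty using (⊥)
open import Data.Unit using (⊤)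
open import Data.Maybe using (just)
open import Relation.Nullary using (¬_)
open import Relation.Binary.PropositionalEquality using (_≡_)

countTrue : ∀ {n} → (Fin n → Bool) → ℕ
countTrue {zero}  f = 0
countTrue {suc n} f = (if f zero then 1 else 0) + countTrue (λ i → f (suc i))

-- A (simple) graph on the vertex set Fin n, given by a Boolean adjacency matrix,
-- and more generally an edge set E (a symmetric Boolean relation).
EdgeSet : ℕ → Set
EdgeSet n = Fin n → Fin n → Bool

deg : ∀ {n} → EdgeSet n → Fin n → ℕ
deg E v = countTrue (E v)

IsWalk : ∀ {n} → EdgeSet n → List (Fin n) → Set
IsWalk E []            = ⊤
IsWalk E (x ∷ [])      = ⊤
IsWalk E (x ∷ y ∷ xs)  = (E x y ≡ true) × IsWalk E (y ∷ xs)

WalkFromTo : ∀ {n} → EdgeSet n → Fin n → Fin n → List (Fin n) → Set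
WalkFromTo E u v []       = ⊥
WalkFromTo E u v (x ∷ xs) = (x ≡ u) × (Data.List.last (x ∷ xs) ≡ just v) × IsWalk E (x ∷ xs)

-- v is a vertex of the subgraph spanned by the edge set E (incident to an edge of E)
InV : ∀ {n} → EdgeSet n → Fin n → Set
InV E v = ∃[ u ] (E v u ≡ true)

IsSimple : ∀ {n} → EdgeSet n → Set
IsSimple E = (∀ u v → E u v ≡ E v u) × (∀ v → E v v ≡ false)

HasCycle : ∀ {n} → EdgeSet n → Set
HasCycle E = ∃[ x ] ∃[ xs ] (2 ≤ length xs × Unique (x ∷ xs) × IsWalk E (x ∷ xs ++ [ x ]))

Acyclic : ∀ {n} → EdgeSet n → Set
Acyclic E = ¬ HasCycle E

record Tree (n : ℕ) : Set where
  field
    adj       : EdgeSet n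
    simple    : IsSimple adj
    connected : ∀ u v → ∃[ w ] WalkFromTo adj u v w
    acyclic   : Acyclic adj

-- A subtree of T given by its edge set S (the subgraph spanned by S):
-- S ⊆ E(T), S simple, connected on its vertex set, acyclic.
record IsSubtree {n} (T : Tree n) (S : EdgeSet n) : Set where
  field
    simple    : IsSimple S
    sub       : ∀ u v → S u v ≡ true → Tree.adj T u v ≡ true
    connected : ∀ u v → InV S u → InV S v → ∃[ w ] WalkFromTo S u v w
    acyclic   : Acyclic S

DegreeAtMost : ∀ {n} → ℕ → EdgeSet n → Set
DegreeAtMost d S = ∀ v → deg S v ≤ d

record DegPartition {n} (T : Tree n) (d k : ℕ) (P : Fin k → EdgeSet n) : Set where
  field
    subtree : ∀ i → IsSubtree T (P i)
    bounded : ∀ i → DegreeAtMost d (P i)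
    cover   : ∀ u v → Tree.adj T u v ≡ true → ∃[ i ] (P i u v ≡ true)
    unique  : ∀ u v i j → P i u v ≡ true → P j u v ≡ true → i ≡ j

HasDegPartition : ∀ {n} → Tree n → ℕ → ℕ → Set
HasDegPartition T d k = ∃[ P ] DegPartition T d k P

IsMinPartitionNumber : ∀ {n} → Tree n → ℕ → ℕ → Set
IsMinPartitionNumber T d m = HasDegPartition T d m × (∀ k → HasDegPartition T d k → m ≤ k)

CongOneMod : ℕ → ℕ → Set
CongOneMod d a = ∃[ q ] (a ≡ 1 + q * d)

-- Let T be a tree on n ≥ 2 vertices and d ≥ 2.  For a partition P of E(T) into k
-- degree-d subtrees let p(v) be the number of pieces containing the vertex v.  Two
-- counts drive the proof:
--   * deg v ≤ d · p(v), since every piece has degree at most d at v;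
--   * Σ_v p(v) = Σ_i |V(Pᵢ)| = Σ_i (|E(Pᵢ)| + 1) = (n - 1) + k, since the pieces are
--     trees (only ≤ when empty pieces are allowed).
-- Call P saturated if at each vertex at most one piece has degree strictly between 0
-- and d.  Then d · (p(v) - 1) < deg v, so p(v) = ⌈deg v / d⌉ is as small as possible and
-- a saturated partition has the fewest pieces.  Summing  d · p(v) + 1 ≤ deg v + d  over
-- all v and using the two counts gives  d · k ≤ d + (n - 2), with equality iff every
-- local bound is tight, i.e. iff deg v ≡ 1 (mod d) for all v.  A saturated partition is
-- built greedily while growing T from a root one vertex at a time.

module Submission where

open import Defs
open import Data.Nat using (ℕ; zero; suc; _+_; _*_; _∸_; _≤_; _<_; z≤n; s≤s; _≤?_; _<?_)
open import Data.Nat.Properties hiding (_≟_; suc-injective)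
open import Data.Nat.Solver using (module +-*-Solver)
open import Algebra.Properties.Semiring.Sum +-*-semiring using (sum; sum-cong-≗; ∑-distrib-+; ∑-comm; *-distribˡ-sum)
open import Data.Fin using (Fin; zero; suc)
open import Data.Fin.Properties using (_≟_; suc-injective; any?)
open import Data.Bool using (Bool; true; false; _∧_; _∨_; not)
open import Data.Bool.Properties using (∨-zeroʳ; ∨-identityʳ; ∧-comm; ∨-comm; ¬-not) renaming (_≟_ to _≟ᴮ_)
open import Data.Product using (Σ; ∃; ∃-syntax; _×_; _,_; proj₁; proj₂)
open import Data.Sum using (_⊎_; inj₁; inj₂; [_,_]′; map₂)
open import Data.Empty using (⊥; ⊥-elim)
open import Data.Unit using (tt)
open import Data.Maybe using (just)
open import Data.List using (List; []; _∷_; _++_; [_]; length; last)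
open import Data.List.Relation.Unary.All using (All; []; _∷_) renaming (map to mapAll; head to headAll)
open import Data.List.Relation.Unary.All.Properties.Core using (¬Any⇒All¬)
open import Data.List.Relation.Unary.Any using (here; there)
open import Data.List.Relation.Unary.AllPairs using ([]; _∷_)
open import Data.List.Relation.Unary.Unique.Propositional using (Unique)
open import Data.List.Membership.Propositional using (_∈_)
import Data.List.Membership.DecPropositional as DecMembership
open import Function using (_∘_)
open import Data.Vec.Functional using (updateAt) renaming (_∷_ to _◂_)
open import Data.Vec.Functional.Properties using (updateAt-updates; updateAt-minimal)
open import Relation.Nullary using (¬_; Dec; yes; no; does)
open import Relation.Nullary.Decidable using (_×-dec_)
open import Relation.Binary.PropositionalEquality hiding ([_])
open import Function.Bundles using (_⇔_; mk⇔; Equivalence)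

open +-*-Solver using (solve; _:+_; _:*_; _:=_; con)

ind : Bool → ℕ
ind true  = 1
ind false = 0

ind-∨ : ∀ x y → (x ≡ true → y ≡ false) → ind (x ∨ y) ≡ ind x + ind y
ind-∨ true  y excl rewrite excl refl = refl
ind-∨ false y excl = refl

∧-true : ∀ {x y} → x ∧ y ≡ true → x ≡ true × y ≡ true
∧-true {true} {true} _ = refl , refl

ind-∧ : ∀ x y → ind (x ∧ y) ≡ ind x * ind y
ind-∧ true  y = sym (+-identityʳ (ind y))
ind-∧ false y = refl

sgn : ℕ → ℕ
sgn zero    = 0
sgn (suc _) = 1

sgn-pos : ∀ x → 1 ≤ x → sgn x ≡ 1
sgn-pos (suc x) _ = refl

≤*sgn : ∀ d x → x ≤ d → x ≤ d * sgn x
≤*sgn d zero    _   = z≤n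
≤*sgn d (suc x) x≤d = subst (suc x ≤_) (sym (*-identityʳ d)) x≤d

-- Boolean equality test on Fin n; it computes structurally on suc.
_==_ : ∀ {n} → Fin n → Fin n → Bool
x == y = does (x ≟ y)

==-sound : ∀ {n} {x y : Fin n} → x == y ≡ true → x ≡ y
==-sound {x = x} {y} e with x ≟ y
... | yes x≡y = x≡y

==-refl : ∀ {n} (x : Fin n) → x == x ≡ true
==-refl x with x ≟ x
... | yes _  = refl
... | no x≢x = ⊥-elim (x≢x refl)

==-false : ∀ {n} {x y : Fin n} → x ≢ y → x == y ≡ false
==-false {x = x} {y} x≢y with x ≟ y
... | yes x≡y = ⊥-elim (x≢y x≡y)
... | no _    = refl

true≢false : true ≢ false
true≢false ()

+-tight : ∀ {a b c d} → a ≤ b → c ≤ d → a + c ≡ b + d → a ≡ b × c ≡ d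
+-tight {a} {b} {c} {d} a≤b c≤d eq = a≡b , +-cancelˡ-≡ a c d (trans eq (cong (_+ d) (sym a≡b)))
  where
    b+c≤a+c : b + c ≤ a + c
    b+c≤a+c = subst (b + c ≤_) (sym eq) (+-monoʳ-≤ b c≤d)
    a≡b : a ≡ b
    a≡b = ≤-antisym a≤b (+-cancelʳ-≤ c b a b+c≤a+c)

sum-const : ∀ n c → sum {n} (λ _ → c) ≡ n * c
sum-const zero    c = refl
sum-const (suc n) c = cong (c +_) (sum-const n c)

sum-zero : ∀ n → sum {n} (λ _ → 0) ≡ 0
sum-zero n = trans (sum-const n 0) (*-zeroʳ n)

sum-mono : ∀ {n} {f g : Fin n → ℕ} → (∀ i → f i ≤ g i) → sum f ≤ sum g
sum-mono {zero}  f≤g = z≤n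
sum-mono {suc n} f≤g = +-mono-≤ (f≤g zero) (sum-mono (f≤g ∘ suc))

sum-tight : ∀ {n} {f g : Fin n → ℕ} → (∀ i → f i ≤ g i) → sum f ≡ sum g → ∀ i → f i ≡ g i
sum-tight {suc n} f≤g eq zero    = proj₁ (+-tight (f≤g zero) (sum-mono (f≤g ∘ suc)) eq)
sum-tight {suc n} f≤g eq (suc i) = sum-tight (f≤g ∘ suc) (proj₂ (+-tight (f≤g zero) (sum-mono (f≤g ∘ suc)) eq)) i

sum-δ : ∀ {n} (w : Fin n) (g : Fin n → ℕ) → sum (λ v → ind (v == w) * g v) ≡ g w
sum-δ {suc n} zero    g = trans (cong₂ _+_ (+-identityʳ (g zero)) (sum-zero n)) (+-identityʳ (g zero))
sum-δ {suc n} (suc w) g = sum-δ w (g ∘ suc)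

countTrue-sum : ∀ {n} (f : Fin n → Bool) → countTrue f ≡ sum (ind ∘ f)
countTrue-sum {zero}  f = refl
countTrue-sum {suc n} f with f zero
... | true  = cong suc (countTrue-sum (f ∘ suc))
... | false = countTrue-sum (f ∘ suc)

count-pos : ∀ {n} (f : Fin n → Bool) i → f i ≡ true → 1 ≤ sum (ind ∘ f)
count-pos {suc n} f zero    e rewrite e = s≤s z≤n
count-pos {suc n} f (suc i) e = ≤-trans (count-pos (f ∘ suc) i e) (m≤n+m _ (ind (f zero)))

count-pos⁻ : ∀ {n} (f : Fin n → Bool) → 1 ≤ sum (ind ∘ f) → ∃ λ i → f i ≡ true
count-pos⁻ {suc n} f pos with f zero in e
... | true  = zero , e
... | false = let (i , fi) = count-pos⁻ (f ∘ suc) pos in suc i , fi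

count-none : ∀ {n} (f : Fin n → Bool) → (∀ i → f i ≡ false) → sum (ind ∘ f) ≡ 0
count-none {n} f none = trans (sum-cong-≗ (cong ind ∘ none)) (sum-zero n)

count-unique : ∀ {n} (f : Fin n → Bool) a → f a ≡ true → (∀ b → f b ≡ true → b ≡ a) →
  sum (ind ∘ f) ≡ 1
count-unique f a fa only-a = trans (sum-cong-≗ pointwise) (sum-δ a (λ _ → 1))
  where
    pointwise : ∀ b → ind (f b) ≡ ind (b == a) * 1
    pointwise b with f b in fb
    ... | true rewrite only-a b fb | ==-refl a = refl
    ... | false with b ≟ a
    ...   | yes refl = ⊥-elim (true≢false (trans (sym fa) fb))
    ...   | no _     = refl

InV⇒deg : ∀ {n} (S : EdgeSet n) v → InV S v → 1 ≤ deg S v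
InV⇒deg S v (u , e) rewrite countTrue-sum (S v) = count-pos (S v) u e

deg⇒InV : ∀ {n} (S : EdgeSet n) v → 1 ≤ deg S v → InV S v
deg⇒InV S v pos rewrite countTrue-sum (S v) = count-pos⁻ (S v) pos

deg-zero : ∀ {n} (S : EdgeSet n) v → (∀ u → S v u ≡ false) → deg S v ≡ 0
deg-zero S v none rewrite countTrue-sum (S v) = count-none (S v) none

InV? : ∀ {n} (S : EdgeSet n) v → Dec (InV S v)
InV? S v = any? (λ u → S v u ≟ᴮ true)

data Walk {n} (E : EdgeSet n) : Fin n → Fin n → Set where
  stop : ∀ {u} → Walk E u u
  step : ∀ {u x v} → E u x ≡ true → Walk E x v → Walk E u v

module _ {n} {E : EdgeSet n} where
  open DecMembership (_≟_ {n}) using (_∈?_)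

  laterVerts : ∀ {u v} → Walk E u v → List (Fin n)
  laterVerts stop                = []
  laterVerts (step {x = x} _ p) = x ∷ laterVerts p

  verts : ∀ {u v} → Walk E u v → List (Fin n)
  verts {u = u} p = u ∷ laterVerts p

  _++ʷ_ : ∀ {u x v} → Walk E u x → Walk E x v → Walk E u v
  stop     ++ʷ q = q
  step e p ++ʷ q = step e (p ++ʷ q)

  ++ʷ-All : ∀ {P : Fin n → Set} {u x v} (p : Walk E u x) (q : Walk E x v) →
    All P (verts p) → All P (verts q) → All P (verts (p ++ʷ q))
  ++ʷ-All stop       q Pp       Pq = Pq
  ++ʷ-All (step e p) q (Pu ∷ Pp) Pq = Pu ∷ ++ʷ-All p q Pp Pq

  module _ (sym-E : ∀ u v → E u v ≡ E v u) where
    reverseʷ : ∀ {u v} → Walk E u v → Walk E v u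
    reverseʷ stop                       = stop
    reverseʷ (step {u = u} {x = x} e p) = reverseʷ p ++ʷ step (trans (sym-E x u) e) stop

    reverseʷ-All : ∀ {P : Fin n → Set} {u v} (p : Walk E u v) →
      All P (verts p) → All P (verts (reverseʷ p))
    reverseʷ-All stop       Pp        = Pp
    reverseʷ-All (step e p) (Pu ∷ Pp) =
      ++ʷ-All (reverseʷ p) (step _ stop) (reverseʷ-All p Pp) (headAll Pp ∷ Pu ∷ [])

  mapʷ : ∀ {F : EdgeSet n} → (∀ u v → E u v ≡ true → F u v ≡ true) → ∀ {u v} → Walk E u v → Walk F u v
  mapʷ E⊆F stop       = stop
  mapʷ E⊆F (step e p) = step (E⊆F _ _ e) (mapʷ E⊆F p)

  start-InV : ∀ {u v} → Walk E u v → u ≢ v → InV E u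
  start-InV stop               u≢v = ⊥-elim (u≢v refl)
  start-InV (step {x = x} e p) _   = x , e

  isWalk-verts : ∀ {u v} (p : Walk E u v) → IsWalk E (verts p)
  isWalk-verts stop                = tt
  isWalk-verts (step e stop)       = e , tt
  isWalk-verts (step e (step f p)) = e , isWalk-verts (step f p)

  last-verts : ∀ {u v} (p : Walk E u v) → last (verts p) ≡ just v
  last-verts stop       = refl
  last-verts (step e p) = last-verts p

  toWalkFromTo : ∀ {u v} (p : Walk E u v) → WalkFromTo E u v (verts p)
  toWalkFromTo p = refl , last-verts p , isWalk-verts p

  fromWalkFromTo : ∀ {u v} xs → WalkFromTo E u v xs → Walk E u v
  fromWalkFromTo {v = v} (x ∷ xs) (refl , ends , walk) = go x xs ends walk
    where
      go : ∀ x xs → last (x ∷ xs) ≡ just v → IsWalk E (x ∷ xs) → Walk E x v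
      go x []       refl _          = stop
      go x (y ∷ ys) ends (e , walk) = step e (go y ys ends walk)

  Path : (Fin n → Set) → Fin n → Fin n → Set
  Path P u v = Σ (Walk E u v) λ q → Unique (verts q) × All P (verts q)

  suffixPath : ∀ {P : Fin n → Set} {u x v} (q : Walk E x v) → u ∈ verts q →
    Unique (verts q) → All P (verts q) → Path P u v
  suffixPath q          (here refl) uq Pq             = q , uq , Pq
  suffixPath stop       (there ())  _  _
  suffixPath (step e q) (there u∈q) (_ ∷ uq) (_ ∷ Pq) = suffixPath q u∈q uq Pq

  toPath : ∀ {P : Fin n → Set} {u v} (p : Walk E u v) → All P (verts p) → Path P u v
  toPath stop Pp = stop , [] ∷ [] , Pp
  toPath {u = u} (step e p) (Pu ∷ Pp) with toPath p Pp
  ... | q , uq , Pq with u ∈? verts q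
  ...   | yes u∈q = suffixPath q u∈q uq Pq
  ...   | no  u∉q = step e q , ¬Any⇒All¬ (verts q) u∉q ∷ uq , Pu ∷ Pq

  snoc-isWalk : ∀ {a b w} (q : Walk E a b) → E b w ≡ true → IsWalk E (a ∷ (laterVerts q ++ [ w ]))
  snoc-isWalk stop       e = e , tt
  snoc-isWalk (step f q) e = f , snoc-isWalk q e

-- In an acyclic graph, a vertex w outside a set P has at most one neighbour among
-- vertices joined by a walk inside P: two distinct such neighbours a, b together with
-- a path from a to b inside P would close a cycle through w.
acyclic-one-neighbour : ∀ {n} {G : EdgeSet n} → Acyclic G → {P : Fin n → Set} → ∀ {w a b} → ¬ P w →
  G w a ≡ true → G b w ≡ true → (p : Walk G a b) → All P (verts p) → a ≡ b
acyclic-one-neighbour {G = G} acyclic {P} {w} {a} {b} ¬Pw wa bw p Pp with a ≟ b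
... | yes a≡b = a≡b
... | no  a≢b with toPath p Pp
...   | q , uq , Pq = ⊥-elim (acyclic (w , verts q , long q a≢b , mapAll w≢ Pq ∷ uq , wa , snoc-isWalk q bw))
  where
    long : ∀ {a b} (q : Walk G a b) → a ≢ b → 2 ≤ length (verts q)
    long stop       a≢b = ⊥-elim (a≢b refl)
    long (step e q) _   = s≤s (s≤s z≤n)
    w≢ : ∀ {y} → P y → w ≢ y
    w≢ Py refl = ¬Pw Py

mapIsWalk : ∀ {n} {S G : EdgeSet n} → (∀ u v → S u v ≡ true → G u v ≡ true) → ∀ xs → IsWalk S xs → IsWalk G xs
mapIsWalk S⊆G []           _           = tt
mapIsWalk S⊆G (x ∷ [])     _           = tt
mapIsWalk S⊆G (x ∷ y ∷ xs) (e , walk) = S⊆G x y e , mapIsWalk S⊆G (y ∷ xs) walk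

acyclic-⊆ : ∀ {n} {S G : EdgeSet n} → (∀ u v → S u v ≡ true → G u v ≡ true) → Acyclic G → Acyclic S
acyclic-⊆ S⊆G acyclic (x , xs , len , uq , walk) = acyclic (x , xs , len , uq , mapIsWalk S⊆G (x ∷ xs ++ [ x ]) walk)

closed-walk : ∀ {n} {G : EdgeSet n} (R : Fin n → Bool) → (∀ a w → R a ≡ true → G a w ≡ true → R w ≡ true) →
  ∀ {u v} → R u ≡ true → Walk G u v → R v ≡ true
closed-walk R closed Ru stop       = Ru
closed-walk R closed Ru (step e p) = closed-walk R closed (closed _ _ Ru e) p

-- Starting from {r} and repeatedly adding a vertex w
-- outside the current set R that is adjacent to some a ∈ R, one reaches a set closed
-- under neighbours.  `grow` is the induction principle for this process: an invariant
-- that holds for {r} and survives each such addition holds for the final set.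
module Grow {n} (G : EdgeSet n) (sym-G : ∀ u v → G u v ≡ G v u) (r : Fin n) where
  add : (Fin n → Bool) → Fin n → Fin n → Bool
  add R w x = R x ∨ (x == w)

  single : Fin n → Bool
  single x = x == r

  Conn : (Fin n → Bool) → Set
  Conn R = ∀ x → R x ≡ true → Σ (Walk G x r) λ p → All (λ y → R y ≡ true) (verts p)

  Closed : (Fin n → Bool) → Set
  Closed R = ∀ a w → R a ≡ true → G a w ≡ true → R w ≡ true

  outside : (Fin n → Bool) → ℕ
  outside R = sum (λ x → ind (not (R x)))

  add-old : ∀ R w {x} → R x ≡ true → add R w x ≡ true
  add-old R w Rx rewrite Rx = refl

  add-new : ∀ R w → add R w w ≡ true
  add-new R w rewrite ==-refl w = ∨-zeroʳ (R w)

  add-cases : ∀ R w x → add R w x ≡ true → R x ≡ true ⊎ x ≡ w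
  add-cases R w x e with R x | x == w in x=w
  ... | true  | _    = inj₁ refl
  ... | false | true = inj₂ (==-sound x=w)

  ind-add : ∀ R w → R w ≡ false → ∀ x → ind (add R w x) ≡ ind (R x) + ind (x == w)
  ind-add R w Rw x with x == w in x=w
  ... | true with ==-sound {x = x} x=w
  ...   | refl rewrite Rw = refl
  ind-add R w Rw x | false rewrite ∨-identityʳ (R x) = sym (+-identityʳ _)

  outside-add : ∀ R w → R w ≡ false → suc (outside (add R w)) ≡ outside R
  outside-add R w Rw = sym (begin
      outside R
    ≡⟨ sum-cong-≗ split ⟩
      sum (λ x → ind (not (add R w x)) + ind (x == w) * 1)
    ≡⟨ ∑-distrib-+ (λ x → ind (not (add R w x))) (λ x → ind (x == w) * 1) ⟩
      outside (add R w) + sum (λ x → ind (x == w) * 1)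
    ≡⟨ cong (outside (add R w) +_) (sum-δ w (λ _ → 1)) ⟩
      outside (add R w) + 1
    ≡⟨ +-comm _ 1 ⟩
      suc (outside (add R w))
    ∎)
    where
      open ≡-Reasoning
      split : ∀ x → ind (not (R x)) ≡ ind (not (add R w x)) + ind (x == w) * 1
      split x with x == w in x=w
      ... | true with ==-sound {x = x} x=w
      ...   | refl rewrite Rw = refl
      split x | false rewrite ∨-identityʳ (R x) = sym (+-identityʳ _)

  crossing : ∀ R → (∃ λ a → ∃ λ w → R a ≡ true × R w ≡ false × G a w ≡ true) ⊎ Closed R
  crossing R with any? (λ a → (R a ≟ᴮ true) ×-dec any? (λ w → (R w ≟ᴮ false) ×-dec (G a w ≟ᴮ true)))
  ... | yes (a , Ra , w , Rw , aw) = inj₁ (a , w , Ra , Rw , aw)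
  ... | no  none                  = inj₂ closed
    where
      closed : Closed R
      closed a w Ra aw with R w in Rw
      ... | true  = refl
      ... | false = ⊥-elim (none (a , Ra , w , Rw , aw))

  conn-single : Conn single
  conn-single x x=r with ==-sound {x = x} x=r
  ... | refl = stop , x=r ∷ []

  conn-add : ∀ R a w → Conn R → R a ≡ true → G a w ≡ true → Conn (add R w)
  conn-add R a w conn Ra aw x x∈R' with add-cases R w x x∈R'
  ... | inj₁ Rx = let (p , Rp) = conn x Rx in p , mapAll (add-old R w) Rp
  ... | inj₂ refl = let (p , Rp) = conn a Ra in
        step (trans (sym-G x a) aw) p , add-new R x ∷ mapAll (add-old R x) Rp

  only-neighbour : Acyclic G → ∀ R {a b w} → Conn R → R a ≡ true → R b ≡ true → R w ≡ false →
    G w a ≡ true → G b w ≡ true → b ≡ a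
  only-neighbour acyclic R conn Ra Rb Rw wa bw =
    let (pa , Rpa) = conn _ Ra ; (pb , Rpb) = conn _ Rb in
    sym (acyclic-one-neighbour acyclic (λ Rw' → true≢false (trans (sym Rw') Rw)) wa bw
           (pa ++ʷ reverseʷ sym-G pb) (++ʷ-All pa (reverseʷ sym-G pb) Rpa (reverseʷ-All sym-G pb Rpb)))

  module _ (Inv : (Fin n → Bool) → Set) (Inv-single : Inv single)
           (Inv-add : ∀ R a w → Conn R → R a ≡ true → R w ≡ false → G a w ≡ true → Inv R → Inv (add R w)) where

    Grown : Set
    Grown = Σ (Fin n → Bool) λ R → R r ≡ true × Conn R × Closed R × Inv R

    -- the process, with the number of outside vertices as termination measure
    growFrom : (fuel : ℕ) → ∀ R → outside R ≤ fuel → R r ≡ true → Conn R → Inv R → Grown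
    growFrom fuel R _ Rr conn inv with crossing R
    ... | inj₂ closed = R , Rr , conn , closed , inv
    growFrom zero R out≤0 _ _ _ | inj₁ (a , w , Ra , Rw , aw)
      with subst (_≤ 0) (sym (outside-add R w Rw)) out≤0
    ... | ()
    growFrom (suc fuel) R out≤ Rr conn inv | inj₁ (a , w , Ra , Rw , aw) =
      growFrom fuel (add R w) (≤-pred (subst (_≤ suc fuel) (sym (outside-add R w Rw)) out≤))
        (add-old R w Rr) (conn-add R a w conn Ra aw) (Inv-add R a w conn Ra Rw aw inv)

    grow : Grown
    grow = growFrom (outside single) single ≤-refl (==-refl r) conn-single Inv-single

-- With f = h the
-- indicator of a vertex set R and g the adjacency matrix, B counts the ordered pairs of
-- adjacent vertices of R, i.e. twice the number of edges inside R.
module Bilinear {n} (g : Fin n → Fin n → ℕ) where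
  B : (Fin n → ℕ) → (Fin n → ℕ) → ℕ
  B f h = sum λ u → sum λ v → f u * h v * g u v

  B-cong : ∀ {f f' h h'} → (∀ u → f u ≡ f' u) → (∀ v → h v ≡ h' v) → B f h ≡ B f' h'
  B-cong f≗f' h≗h' = sum-cong-≗ λ u → sum-cong-≗ λ v → cong₂ (λ a b → a * b * _) (f≗f' u) (h≗h' v)

  B-+ˡ : ∀ f f' h → B (λ u → f u + f' u) h ≡ B f h + B f' h
  B-+ˡ f f' h = trans (sum-cong-≗ λ u → trans (sum-cong-≗ λ v → expand (f u) (f' u) (h v) (g u v))
                                                (∑-distrib-+ {n} _ _))
                      (∑-distrib-+ {n} _ _)
    where
      expand : ∀ a b c e → (a + b) * c * e ≡ a * c * e + b * c * e
      expand = solve 4 (λ a b c e → (a :+ b) :* c :* e := a :* c :* e :+ b :* c :* e) refl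

  B-+ʳ : ∀ f h h' → B f (λ v → h v + h' v) ≡ B f h + B f h'
  B-+ʳ f h h' = trans (sum-cong-≗ λ u → trans (sum-cong-≗ λ v → expand (f u) (h v) (h' v) (g u v))
                                                (∑-distrib-+ {n} _ _))
                      (∑-distrib-+ {n} _ _)
    where
      expand : ∀ a b c e → a * (b + c) * e ≡ a * b * e + a * c * e
      expand = solve 4 (λ a b c e → a :* (b :+ c) :* e := a :* b :* e :+ a :* c :* e) refl

  B-δˡ : ∀ w h → B (λ u → ind (u == w)) h ≡ sum (λ v → h v * g w v)
  B-δˡ w h = trans (sum-cong-≗ λ u → trans (sum-cong-≗ λ v → *-assoc (ind (u == w)) (h v) (g u v))
                                           (sym (*-distribˡ-sum (ind (u == w)) (λ v → h v * g u v))))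
                   (sum-δ w (λ u → sum (λ v → h v * g u v)))

  B-δʳ : ∀ f w → B f (λ v → ind (v == w)) ≡ sum (λ u → f u * g u w)
  B-δʳ f w = sum-cong-≗ λ u → trans (sum-cong-≗ λ v → reorder (f u) (ind (v == w)) (g u v))
                                     (sum-δ w (λ v → f u * g u v))
    where
      reorder : ∀ a b c → a * b * c ≡ b * (a * c)
      reorder = solve 3 (λ a b c → a :* b :* c := b :* (a :* c)) refl

order : ∀ {n} → EdgeSet n → ℕ
order G = sum (λ v → sgn (deg G v))

degSum : ∀ {n} → EdgeSet n → ℕ
degSum G = sum (deg G)

-- Proof: grow a vertex set R from a vertex r as in `Grow`, keeping track of its size
-- and of B R R, twice the number of edges inside R.  Adding a vertex w adds one vertex
-- and as many edges as w has neighbours in R: at least one, and exactly one when G is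
-- acyclic (`acyclic-one-neighbour`).  The final set is the whole vertex set of G.
module EdgeCount {n} (G : EdgeSet n) (simple : IsSimple G) (r : Fin n) (r∈G : InV G r)
                 (conn : ∀ u v → InV G u → InV G v → Walk G u v) where
  sym-G : ∀ u v → G u v ≡ G v u
  sym-G = proj₁ simple

  open Grow G sym-G r
  open Bilinear (λ u v → ind (G u v))

  ρ : (Fin n → Bool) → Fin n → ℕ
  ρ R x = ind (R x)

  size : (Fin n → Bool) → ℕ
  size R = sum (ρ R)

  inner : (Fin n → Bool) → ℕ
  inner R = B (ρ R) (ρ R)

  nbrs : (Fin n → Bool) → Fin n → ℕ
  nbrs R w = sum (λ v → ρ R v * ind (G w v))

  size-add : ∀ R w → R w ≡ false → size (add R w) ≡ size R + 1
  size-add R w Rw = begin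
      size (add R w)                              ≡⟨ sum-cong-≗ split ⟩
      sum (λ x → ρ R x + ind (x == w) * 1)        ≡⟨ ∑-distrib-+ (ρ R) (λ x → ind (x == w) * 1) ⟩
      size R + sum (λ x → ind (x == w) * 1)       ≡⟨ cong (size R +_) (sum-δ w (λ _ → 1)) ⟩
      size R + 1                                  ∎
    where
      open ≡-Reasoning
      split : ∀ x → ρ (add R w) x ≡ ρ R x + ind (x == w) * 1
      split x = trans (ind-add R w Rw x) (cong (ρ R x +_) (sym (*-identityʳ _)))

  inner-add : ∀ R w → R w ≡ false → inner (add R w) ≡ inner R + 2 * nbrs R w
  inner-add R w Rw = begin
      inner (add R w)
    ≡⟨ B-cong (ind-add R w Rw) (ind-add R w Rw) ⟩
      B (λ u → ρ R u + δ u) (λ v → ρ R v + δ v)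
    ≡⟨ trans (B-+ˡ (ρ R) δ _) (cong₂ _+_ (B-+ʳ (ρ R) (ρ R) δ) (B-+ʳ δ (ρ R) δ)) ⟩
      (inner R + B (ρ R) δ) + (B δ (ρ R) + B δ δ)
    ≡⟨ cong₂ _+_ (cong (inner R +_) (trans (B-δʳ (ρ R) w) into-nbrs))
                 (cong₂ _+_ (B-δˡ w (ρ R)) (trans (B-δˡ w δ) no-loop)) ⟩
      (inner R + nbrs R w) + (nbrs R w + 0)
    ≡⟨ solve 2 (λ i k → (i :+ k) :+ (k :+ con 0) := i :+ con 2 :* k) refl (inner R) (nbrs R w) ⟩
      inner R + 2 * nbrs R w
    ∎
    where
      open ≡-Reasoning
      δ : Fin n → ℕ
      δ u = ind (u == w)
      into-nbrs : sum (λ u → ρ R u * ind (G u w)) ≡ nbrs R w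
      into-nbrs = sum-cong-≗ (λ u → cong (λ b → ρ R u * ind b) (sym-G u w))
      no-loop : sum (λ v → δ v * ind (G w v)) ≡ 0
      no-loop = trans (sum-δ w (λ v → ind (G w v))) (cong ind (proj₂ simple w))

  nbrs-count : ∀ R w → nbrs R w ≡ sum (λ v → ind (R v ∧ G w v))
  nbrs-count R w = sum-cong-≗ λ v → sym (ind-∧ (R v) (G w v))

  nbrs-pos : ∀ R a w → R a ≡ true → G w a ≡ true → 1 ≤ nbrs R w
  nbrs-pos R a w Ra wa rewrite nbrs-count R w =
    count-pos (λ v → R v ∧ G w v) a (subst (λ b → b ∧ G w a ≡ true) (sym Ra) wa)

  nbrs-one : Acyclic G → ∀ R a w → Conn R → R a ≡ true → R w ≡ false → G a w ≡ true → nbrs R w ≡ 1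
  nbrs-one acyclic R a w conn Ra Rw aw rewrite nbrs-count R w =
    count-unique (λ v → R v ∧ G w v) a (subst (λ b → b ∧ G w a ≡ true) (sym Ra) wa) only-a
    where
      wa : G w a ≡ true
      wa = trans (sym-G w a) aw
      only-a : ∀ b → R b ∧ G w b ≡ true → b ≡ a
      only-a b Rb∧wb = let (Rb , wb) = ∧-true Rb∧wb in
        only-neighbour acyclic R conn Ra Rb Rw wa (trans (sym-G b w) wb)

  Inv : (Fin n → Bool) → Set
  Inv R = 2 * size R ≤ inner R + 2 × (Acyclic G → inner R + 2 ≡ 2 * size R)

  size-single : size single ≡ 1
  size-single = trans (sum-cong-≗ (λ x → sym (*-identityʳ (ρ single x)))) (sum-δ r (λ _ → 1))

  inner-single : inner single ≡ 0
  inner-single = trans (B-δˡ r (ρ single)) (trans (sum-δ r (λ v → ind (G r v))) (cong ind (proj₂ simple r)))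

  Inv-single : Inv single
  Inv-single rewrite size-single | inner-single = ≤-refl , λ _ → refl

  Inv-add : ∀ R a w → Conn R → R a ≡ true → R w ≡ false → G a w ≡ true → Inv R → Inv (add R w)
  Inv-add R a w conn Ra Rw aw (size≤ , size≡) rewrite size-add R w Rw | inner-add R w Rw =
    grow-≤ (size R) (inner R) (nbrs R w) size≤ (nbrs-pos R a w Ra (trans (sym-G w a) aw)) ,
    λ acyclic → subst (λ k → inner R + 2 * k + 2 ≡ 2 * (size R + 1))
                      (sym (nbrs-one acyclic R a w conn Ra Rw aw)) (grow-≡ (size R) (inner R) (size≡ acyclic))
    where
      grow-≤ : ∀ s i k → 2 * s ≤ i + 2 → 1 ≤ k → 2 * (s + 1) ≤ i + 2 * k + 2
      grow-≤ s i k h 1≤k = begin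
        2 * (s + 1)    ≡⟨ *-distribˡ-+ 2 s 1 ⟩
        2 * s + 2      ≤⟨ +-monoˡ-≤ 2 h ⟩
        i + 2 * 1 + 2  ≤⟨ +-monoˡ-≤ 2 (+-monoʳ-≤ i (*-monoʳ-≤ 2 1≤k)) ⟩
        i + 2 * k + 2  ∎
        where open ≤-Reasoning
      grow-≡ : ∀ s i → i + 2 ≡ 2 * s → i + 2 * 1 + 2 ≡ 2 * (s + 1)
      grow-≡ s i h = trans (cong (_+ 2) h) (sym (*-distribˡ-+ 2 s 1))

  -- The grown set is exactly the vertex set of G, so its size and inner count are
  -- the order and the degree sum of G.
  edgeCount : 2 * order G ≤ degSum G + 2 × (Acyclic G → degSum G + 2 ≡ 2 * order G)
  edgeCount with grow Inv Inv-single Inv-add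
  ... | R , Rr , connR , closed , (size≤ , size≡) =
        subst₂ (λ a b → 2 * a ≤ b + 2) size≡order inner≡degSum size≤ ,
        λ acyclic → subst₂ (λ a b → b + 2 ≡ 2 * a) size≡order inner≡degSum (size≡ acyclic)
    where
      R⇒InV : ∀ x → R x ≡ true → InV G x
      R⇒InV x Rx with x ≟ r
      ... | yes refl = r∈G
      ... | no  x≢r  = start-InV (proj₁ (connR x Rx)) x≢r
      InV⇒R : ∀ x → InV G x → R x ≡ true
      InV⇒R x x∈G = closed-walk R closed Rr (conn r x r∈G x∈G)
      ρ≡sgn : ∀ x → ρ R x ≡ sgn (deg G x)
      ρ≡sgn x with R x in Rx
      ... | true = sym (sgn-pos _ (InV⇒deg G x (R⇒InV x Rx)))
      ... | false with deg G x in dx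
      ...   | zero  = refl
      ...   | suc _ = ⊥-elim (true≢false (trans (sym (InV⇒R x (deg⇒InV G x (subst (1 ≤_) (sym dx) (s≤s z≤n))))) Rx))
      size≡order : size R ≡ order G
      size≡order = sum-cong-≗ ρ≡sgn
      edge-in-R : ∀ u v → ρ R u * ρ R v * ind (G u v) ≡ ind (G u v)
      edge-in-R u v with G u v in uv
      ... | false = *-zeroʳ (ρ R u * ρ R v)
      ... | true rewrite InV⇒R u (v , uv) | InV⇒R v (u , trans (sym-G v u) uv) = refl
      inner≡degSum : inner R ≡ degSum G
      inner≡degSum = sum-cong-≗ λ u → trans (sum-cong-≗ (edge-in-R u)) (sym (countTrue-sum (G u)))

pieces : ∀ {n k} → (Fin k → EdgeSet n) → Fin n → ℕ
pieces P v = sum (λ i → sgn (deg (P i) v))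

module PartitionCount {n} (T : Tree n) (d k : ℕ) (P : Fin k → EdgeSet n) (part : DegPartition T d k P) where
  open DegPartition part
  open Tree T using (adj)

  -- every edge at v lies in exactly one piece
  deg-split : ∀ v → deg adj v ≡ sum (λ i → deg (P i) v)
  deg-split v = begin
      deg adj v                              ≡⟨ countTrue-sum (adj v) ⟩
      sum (λ u → ind (adj v u))              ≡⟨ sum-cong-≗ one-piece ⟩
      sum (λ u → sum (λ i → ind (P i v u)))  ≡⟨ ∑-comm (λ u i → ind (P i v u)) ⟩
      sum (λ i → sum (λ u → ind (P i v u)))  ≡⟨ sum-cong-≗ (λ i → sym (countTrue-sum (P i v))) ⟩
      sum (λ i → deg (P i) v)                ∎
    where
      open ≡-Reasoning
      one-piece : ∀ u → ind (adj v u) ≡ sum (λ i → ind (P i v u))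
      one-piece u with adj v u in vu
      ... | true = let (i , Pi) = cover v u vu in
                   sym (count-unique (λ j → P j v u) i Pi (λ j Pj → unique v u j i Pj Pi))
      ... | false = sym (count-none (λ j → P j v u) not-in)
        where
          not-in : ∀ j → P j v u ≡ false
          not-in j = ¬-not λ Pj → true≢false (trans (sym (IsSubtree.sub (subtree j) v u Pj)) vu)

  deg≤ : ∀ v → deg adj v ≤ d * pieces P v
  deg≤ v = begin
      deg adj v                          ≡⟨ deg-split v ⟩
      sum (λ i → deg (P i) v)            ≤⟨ sum-mono (λ i → ≤*sgn d _ (bounded i v)) ⟩
      sum (λ i → d * sgn (deg (P i) v))  ≡⟨ *-distribˡ-sum d (λ i → sgn (deg (P i) v)) ⟨
      d * pieces P v                     ∎
    where open ≤-Reasoning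

  module Piece (i : Fin k) where
    walk : ∀ u v → InV (P i) u → InV (P i) v → Walk (P i) u v
    walk u v u∈ v∈ = let (w , w-walk) = IsSubtree.connected (subtree i) u v u∈ v∈ in fromWalkFromTo w w-walk

    edgeCount : ∀ r → InV (P i) r →
      2 * order (P i) ≤ degSum (P i) + 2 × (Acyclic (P i) → degSum (P i) + 2 ≡ 2 * order (P i))
    edgeCount r r∈ = EdgeCount.edgeCount (P i) (IsSubtree.simple (subtree i)) r r∈ walk

    order≤ : 2 * order (P i) ≤ degSum (P i) + 2
    order≤ with any? (InV? (P i))
    ... | yes (r , r∈) = proj₁ (edgeCount r r∈)
    ... | no  empty    = subst (λ x → 2 * x ≤ degSum (P i) + 2) (sym no-vertices) z≤n
      where
        no-vertices : order (P i) ≡ 0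
        no-vertices = trans (sum-cong-≗ λ v → cong sgn (deg-zero (P i) v (λ u → ¬-not (λ e → empty (v , u , e)))))
                            (sum-zero n)

    order≡ : ∃ (InV (P i)) → degSum (P i) + 2 ≡ 2 * order (P i)
    order≡ (r , r∈) = proj₂ (edgeCount r r∈) (IsSubtree.acyclic (subtree i))

  open Piece using (order≤; order≡)

  -- counting vertex–piece incidences in two ways
  incidences : 2 * sum (pieces P) ≡ sum (λ i → 2 * order (P i))
  incidences = trans (cong (2 *_) (∑-comm (λ v i → sgn (deg (P i) v))))
                     (*-distribˡ-sum 2 (λ i → order (P i)))

  degSum-split : sum (λ i → degSum (P i) + 2) ≡ degSum adj + k * 2
  degSum-split = begin
      sum (λ i → degSum (P i) + 2)                 ≡⟨ ∑-distrib-+ {k} (λ i → degSum (P i)) (λ _ → 2) ⟩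
      sum (λ i → degSum (P i)) + sum {k} (λ _ → 2) ≡⟨ cong₂ _+_ (sym (∑-comm (λ v i → deg (P i) v))) (sum-const k 2) ⟩
      sum (λ v → sum (λ i → deg (P i) v)) + k * 2  ≡⟨ cong (_+ k * 2) (sum-cong-≗ (sym ∘ deg-split)) ⟩
      degSum adj + k * 2                           ∎
    where open ≡-Reasoning

  pieces-≤ : 2 * sum (pieces P) ≤ degSum adj + k * 2
  pieces-≤ = subst₂ _≤_ (sym incidences) degSum-split (sum-mono order≤)

  pieces-≡ : (∀ i → ∃ (InV (P i))) → 2 * sum (pieces P) ≡ degSum adj + k * 2
  pieces-≡ nonempty = trans incidences (trans (sum-cong-≗ (λ i → sym (order≡ i (nonempty i)))) degSum-split)

module AddEdge {n} (a w : Fin n) (a≢w : a ≢ w) where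
  edge : EdgeSet n
  edge u v = (u == a ∧ v == w) ∨ (u == w ∧ v == a)

  _+edge : EdgeSet n → EdgeSet n
  (S +edge) u v = S u v ∨ edge u v

  edge-ends : ∀ u v → edge u v ≡ true → (u ≡ a × v ≡ w) ⊎ (u ≡ w × v ≡ a)
  edge-ends u v e with u == a in ua | v == w in vw | u == w in uw | v == a in va
  ... | true  | true  | _    | _    = inj₁ (==-sound ua , ==-sound vw)
  ... | true  | false | true | true = inj₂ (==-sound uw , ==-sound va)
  ... | false | _     | true | true = inj₂ (==-sound uw , ==-sound va)

  edge-aw : edge a w ≡ true
  edge-aw rewrite ==-refl a | ==-refl w = refl

  edge-sym : ∀ u v → edge u v ≡ edge v u
  edge-sym u v = trans (cong₂ _∨_ (∧-comm (u == a) (v == w)) (∧-comm (u == w) (v == a)))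
                       (∨-comm (v == w ∧ u == a) (v == a ∧ u == w))

  edge-irrefl : ∀ u → edge u u ≡ false
  edge-irrefl u = ¬-not λ e → [ (λ (p , q) → a≢w (trans (sym p) q)) , (λ (p , q) → a≢w (trans (sym q) p)) ]′
                                (edge-ends u u e)

  ⊆+edge : ∀ S u v → S u v ≡ true → (S +edge) u v ≡ true
  ⊆+edge S u v e rewrite e = refl

  edge⊆+edge : ∀ S u v → edge u v ≡ true → (S +edge) u v ≡ true
  edge⊆+edge S u v e rewrite e = ∨-zeroʳ (S u v)

  +edge-cases : ∀ S u v → (S +edge) u v ≡ true → S u v ≡ true ⊎ edge u v ≡ true
  +edge-cases S u v e with S u v
  ... | true  = inj₁ refl
  ... | false = inj₂ e

  +edge-sym : ∀ S → (∀ u v → S u v ≡ S v u) → ∀ u v → (S +edge) u v ≡ (S +edge) v u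
  +edge-sym S sym-S u v = cong₂ _∨_ (sym-S u v) (edge-sym u v)

  +edge-irrefl : ∀ S → (∀ v → S v v ≡ false) → ∀ v → (S +edge) v v ≡ false
  +edge-irrefl S irr v rewrite irr v = edge-irrefl v

  +edge-⊆ : ∀ S (G : EdgeSet n) → (∀ u v → S u v ≡ true → G u v ≡ true) → G a w ≡ true → G w a ≡ true →
    ∀ u v → (S +edge) u v ≡ true → G u v ≡ true
  +edge-⊆ S G S⊆G aw wa u v e with +edge-cases S u v e
  ... | inj₁ Suv = S⊆G u v Suv
  ... | inj₂ Euv with edge-ends u v Euv
  ...   | inj₁ (refl , refl) = aw
  ...   | inj₂ (refl , refl) = wa

  +edge-connected : ∀ S → (∀ u v → S u v ≡ S v u) → (∀ u → InV S u → Walk S u a) →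
    ∀ u v → InV (S +edge) u → InV (S +edge) v → Walk (S +edge) u v
  +edge-connected S sym-S reach u v u∈ v∈ = to-a u u∈ ++ʷ reverseʷ (+edge-sym S sym-S) (to-a v v∈)
    where
      to-a : ∀ u → InV (S +edge) u → Walk (S +edge) u a
      to-a u (x , e) with +edge-cases S u x e
      ... | inj₁ Sux = mapʷ (⊆+edge S) (reach u (x , Sux))
      ... | inj₂ Eux with edge-ends u x Eux
      ...   | inj₁ (refl , _) = stop
      ...   | inj₂ (refl , _) = step (edge⊆+edge S w a (trans (edge-sym w a) edge-aw)) stop

  deg-edge : ∀ v → deg edge v ≡ ind (v == a) + ind (v == w)
  deg-edge v = begin
      deg edge v
    ≡⟨ countTrue-sum (edge v) ⟩
      sum (λ u → ind (edge v u))
    ≡⟨ sum-cong-≗ split ⟩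
      sum (λ u → ind (u == w) * ind (v == a) + ind (u == a) * ind (v == w))
    ≡⟨ ∑-distrib-+ {n} (λ u → ind (u == w) * ind (v == a)) (λ u → ind (u == a) * ind (v == w)) ⟩
      sum (λ u → ind (u == w) * ind (v == a)) + sum (λ u → ind (u == a) * ind (v == w))
    ≡⟨ cong₂ _+_ (sum-δ w (λ _ → ind (v == a))) (sum-δ a (λ _ → ind (v == w))) ⟩
      ind (v == a) + ind (v == w)
    ∎
    where
      open ≡-Reasoning
      split : ∀ u → ind (edge v u) ≡ ind (u == w) * ind (v == a) + ind (u == a) * ind (v == w)
      split u = trans (ind-∨ (v == a ∧ u == w) (v == w ∧ u == a) exclusive)
                      (cong₂ _+_ (trans (ind-∧ (v == a) (u == w)) (*-comm (ind (v == a)) _))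
                                 (trans (ind-∧ (v == w) (u == a)) (*-comm (ind (v == w)) _)))
        where
          exclusive : v == a ∧ u == w ≡ true → v == w ∧ u == a ≡ false
          exclusive va∧uw = ¬-not λ vw∧ua →
            a≢w (trans (sym (==-sound {x = v} (proj₁ (∧-true va∧uw)))) (==-sound {x = v} (proj₁ (∧-true vw∧ua))))

  deg-+edge : ∀ S → (∀ u v → edge u v ≡ true → S u v ≡ false) →
    ∀ v → deg (S +edge) v ≡ deg S v + (ind (v == a) + ind (v == w))
  deg-+edge S fresh v = begin
      deg (S +edge) v
    ≡⟨ countTrue-sum ((S +edge) v) ⟩
      sum (λ u → ind ((S +edge) v u))
    ≡⟨ sum-cong-≗ disjoint ⟩
      sum (λ u → ind (S v u) + ind (edge v u))
    ≡⟨ ∑-distrib-+ {n} (λ u → ind (S v u)) (λ u → ind (edge v u)) ⟩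
      sum (λ u → ind (S v u)) + sum (λ u → ind (edge v u))
    ≡⟨ cong₂ _+_ (sym (countTrue-sum (S v))) (sym (countTrue-sum (edge v))) ⟩
      deg S v + deg edge v
    ≡⟨ cong (deg S v +_) (deg-edge v) ⟩
      deg S v + (ind (v == a) + ind (v == w))
    ∎
    where
      open ≡-Reasoning
      disjoint : ∀ u → ind ((S +edge) v u) ≡ ind (S v u) + ind (edge v u)
      disjoint u = ind-∨ (S v u) (edge v u) (λ Svu → ¬-not λ e → true≢false (trans (sym Svu) (fresh v u e)))

NonFull : ℕ → ℕ → Set
NonFull d x = 1 ≤ x × x < d

NonFull? : ∀ d x → Dec (NonFull d x)
NonFull? d x = (1 ≤? x) ×-dec (x <? d)

emptyE : ∀ {n} → EdgeSet n
emptyE _ _ = false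

record Saturated {n} (T : Tree n) (d k : ℕ) (P : Fin k → EdgeSet n) : Set where
  field
    partition  : DegPartition T d k P
    nonempty   : ∀ i → ∃ (InV (P i))
    oneNonFull : ∀ v i j → NonFull d (deg (P i) v) → NonFull d (deg (P j) v) → i ≡ j

-- Grow a vertex set R from r as in `Grow`, maintaining a
-- partition of the edges of T inside R into degree-d subtrees such that at every vertex
-- at most one piece is non-full.  When w is attached to R through its unique neighbour
-- a ∈ R, the edge aw is added to the non-full piece at a if there is one; otherwise it
-- becomes a new piece.  In both cases the piece receiving aw has room at a, is the only
-- non-full piece there, and all its vertices reach a; `Extend` treats them uniformly,
-- the second case after prepending an empty piece.
module Greedy {n} (T : Tree n) (d : ℕ) (2≤d : 2 ≤ d) (r : Fin n) where
  open Tree T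
  sym-T : ∀ u v → adj u v ≡ adj v u
  sym-T = proj₁ simple

  open Grow adj sym-T r

  record Family (R : Fin n → Bool) (k : ℕ) (P : Fin k → EdgeSet n) : Set where
    field
      symm       : ∀ i u v → P i u v ≡ P i v u
      irrefl     : ∀ i v → P i v v ≡ false
      ⊆T         : ∀ i u v → P i u v ≡ true → adj u v ≡ true
      conn       : ∀ i u v → InV (P i) u → InV (P i) v → Walk (P i) u v
      bounded    : ∀ i v → deg (P i) v ≤ d
      inside     : ∀ i u v → P i u v ≡ true → R u ≡ true
      covers     : ∀ u v → adj u v ≡ true → R u ≡ true → R v ≡ true → ∃ λ i → P i u v ≡ true
      disjoint   : ∀ u v i j → P i u v ≡ true → P j u v ≡ true → i ≡ j
      oneNonFull : ∀ v i j → NonFull d (deg (P i) v) → NonFull d (deg (P j) v) → i ≡ j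

  State : (Fin n → Bool) → Set
  State R = ∃ λ k → Σ (Fin k → EdgeSet n) λ P → Family R k P × (∀ i → ∃ (InV (P i)))

  State-single : State single
  State-single = 0 , P₀ , family , λ ()
    where
      P₀ : Fin 0 → EdgeSet n
      P₀ ()
      no-edge : ∀ u v → adj u v ≡ true → single u ≡ true → single v ≡ true → ∃ λ i → P₀ i u v ≡ true
      no-edge u v uv u=r v=r with ==-sound {x = u} u=r | ==-sound {x = v} v=r
      ... | refl | refl = ⊥-elim (true≢false (trans (sym uv) (proj₂ simple u)))
      family : Family single 0 P₀
      family = record
        { symm = λ () ; irrefl = λ () ; ⊆T = λ () ; conn = λ () ; bounded = λ () ; inside = λ ()
        ; covers = no-edge ; disjoint = λ _ _ () ; oneNonFull = λ _ () }

  module Step (R : Fin n → Bool) (a w : Fin n) (connR : Conn R) (Ra : R a ≡ true) (Rw : R w ≡ false)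
              (aw : adj a w ≡ true) where
    a≢w : a ≢ w
    a≢w refl = true≢false (trans (sym Ra) Rw)

    open AddEdge a w a≢w

    wa : adj w a ≡ true
    wa = trans (sym-T w a) aw

    only-nbr : ∀ b → R b ≡ true → adj b w ≡ true → b ≡ a
    only-nbr b Rb bw = only-neighbour acyclic R connR Ra Rb Rw wa bw

    new-edges : ∀ u v → adj u v ≡ true → add R w u ≡ true → add R w v ≡ true →
      (R u ≡ true × R v ≡ true) ⊎ edge u v ≡ true
    new-edges u v uv R'u R'v with add-cases R w u R'u | add-cases R w v R'v
    ... | inj₁ Ru | inj₁ Rv = inj₁ (Ru , Rv)
    ... | inj₁ Ru | inj₂ refl rewrite only-nbr u Ru uv = inj₂ edge-aw
    ... | inj₂ refl | inj₁ Rv rewrite only-nbr v Rv (trans (sym-T v u) uv) = inj₂ (trans (edge-sym u a) edge-aw)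
    ... | inj₂ refl | inj₂ refl = ⊥-elim (true≢false (trans (sym uv) (proj₂ simple u)))

    edge-in-R' : ∀ u v → edge u v ≡ true → add R w u ≡ true
    edge-in-R' u v e with edge-ends u v e
    ... | inj₁ (refl , _) = add-old R w Ra
    ... | inj₂ (refl , _) = add-new R u

    δ-a : ind (a == a) + ind (a == w) ≡ 1
    δ-a rewrite ==-refl a | ==-false a≢w = refl

    δ-w : ind (w == a) + ind (w == w) ≡ 1
    δ-w rewrite ==-refl w | ==-false (a≢w ∘ sym) = refl

    δ-other : ∀ v → v ≢ a → v ≢ w → ind (v == a) + ind (v == w) ≡ 0
    δ-other v v≢a v≢w rewrite ==-false v≢a | ==-false v≢w = refl

    module _ {k} {P : Fin k → EdgeSet n} (F : Family R k P) where
      open Family F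

      untouched : ∀ j x → P j w x ≡ false
      untouched j x = ¬-not λ e → true≢false (trans (sym (inside j w x e)) Rw)

      deg-w : ∀ j → deg (P j) w ≡ 0
      deg-w j = deg-zero (P j) w (untouched j)

      edge-new : ∀ j u v → edge u v ≡ true → P j u v ≡ false
      edge-new j u v e with edge-ends u v e
      ... | inj₁ (refl , refl) = trans (symm j a w) (untouched j a)
      ... | inj₂ (refl , refl) = untouched j a

      prepend : Family R (suc k) (emptyE ◂ P)
      prepend = record
        { symm = λ { zero _ _ → refl ; (suc j) → symm j }
        ; irrefl = λ { zero _ → refl ; (suc j) → irrefl j }
        ; ⊆T = λ { zero _ _ () ; (suc j) → ⊆T j }
        ; conn = λ { zero _ _ (_ , ()) ; (suc j) → conn j }
        ; bounded = λ { zero v → subst (_≤ d) (sym (deg-zero emptyE v (λ _ → refl))) z≤n ; (suc j) → bounded j }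
        ; inside = λ { zero _ _ () ; (suc j) → inside j }
        ; covers = λ u v uv Ru Rv → let (j , Pj) = covers u v uv Ru Rv in suc j , Pj
        ; disjoint = λ { _ _ zero zero _ _ → refl ; u v (suc i) (suc j) Pi Pj → cong suc (disjoint u v i j Pi Pj)
                       ; _ _ zero (suc _) () _ ; _ _ (suc _) zero _ () }
        ; oneNonFull = λ { _ zero zero _ _ → refl ; v (suc i) (suc j) nfi nfj → cong suc (oneNonFull v i j nfi nfj)
                         ; v zero (suc _) nf _ → empty-full v nf ; v (suc _) zero _ nf → empty-full v nf } }
        where
          empty-full : ∀ {A : Set} v → NonFull d (deg emptyE v) → A
          empty-full v nf with subst (1 ≤_) (deg-zero emptyE v (λ _ → refl)) (proj₁ nf)
          ... | ()

      module Extend (i : Fin k) (room : deg (P i) a < d) (only-i : ∀ j → NonFull d (deg (P j) a) → j ≡ i)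
                    (reach : ∀ u → InV (P i) u → Walk (P i) u a) where
        P' : Fin k → EdgeSet n
        P' = updateAt P i _+edge

        on-piece : ∀ {ℓ} (Q : Fin k → EdgeSet n → Set ℓ) → Q i (P i +edge) → (∀ j → j ≢ i → Q j (P j)) →
          ∀ j → Q j (P' j)
        on-piece Q new old j with j ≟ i
        ... | yes refl = subst (Q j) (sym (updateAt-updates j P)) new
        ... | no  j≢i  = subst (Q j) (sym (updateAt-minimal j i P j≢i)) (old j j≢i)

        grows : ∀ j u v → P j u v ≡ true → P' j u v ≡ true
        grows = on-piece (λ j S → ∀ u v → P j u v ≡ true → S u v ≡ true) (⊆+edge (P i)) (λ _ _ _ _ e → e)

        gets-edge : ∀ u v → edge u v ≡ true → P' i u v ≡ true
        gets-edge u v e = subst (λ S → S u v ≡ true) (sym (updateAt-updates i P)) (edge⊆+edge (P i) u v e)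

        P'-cases : ∀ j u v → P' j u v ≡ true → P j u v ≡ true ⊎ (j ≡ i × edge u v ≡ true)
        P'-cases = on-piece (λ j S → ∀ u v → S u v ≡ true → P j u v ≡ true ⊎ (j ≡ i × edge u v ≡ true))
                            (λ u v e → map₂ (refl ,_) (+edge-cases (P i) u v e)) (λ _ _ _ _ e → inj₁ e)

        deg-other : ∀ j v → j ≢ i → deg (P' j) v ≡ deg (P j) v
        deg-other j v j≢i = cong (λ S → deg S v) (updateAt-minimal j i P j≢i)

        deg-i : ∀ v → deg (P' i) v ≡ deg (P i) v + (ind (v == a) + ind (v == w))
        deg-i v = trans (cong (λ S → deg S v) (updateAt-updates i P)) (deg-+edge (P i) (edge-new i) v)

        deg-i-a : deg (P' i) a ≡ suc (deg (P i) a)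
        deg-i-a = trans (deg-i a) (trans (cong (deg (P i) a +_) δ-a) (+-comm _ 1))

        deg-i-w : deg (P' i) w ≡ 1
        deg-i-w = trans (deg-i w) (cong₂ _+_ (deg-w i) δ-w)

        deg-elsewhere : ∀ j v → v ≢ a → v ≢ w → deg (P' j) v ≡ deg (P j) v
        deg-elsewhere j v v≢a v≢w with j ≟ i
        ... | yes refl = trans (deg-i v) (trans (cong (deg (P i) v +_) (δ-other v v≢a v≢w)) (+-identityʳ _))
        ... | no  j≢i  = deg-other j v j≢i

        bounded' : ∀ j v → deg (P' j) v ≤ d
        bounded' j v with j ≟ i | v ≟ a | v ≟ w
        ... | no j≢i   | _        | _        = subst (_≤ d) (sym (deg-other j v j≢i)) (bounded j v)
        ... | yes refl | yes refl | _        = subst (_≤ d) (sym deg-i-a) room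
        ... | yes refl | no _     | yes refl = subst (_≤ d) (sym deg-i-w) (≤-trans (s≤s z≤n) 2≤d)
        ... | yes refl | no v≢a   | no v≢w   = subst (_≤ d) (sym (deg-elsewhere i v v≢a v≢w)) (bounded i v)

        nonFull-at-a : ∀ j → NonFull d (deg (P' j) a) → j ≡ i
        nonFull-at-a j nf with j ≟ i
        ... | yes j≡i = j≡i
        ... | no  j≢i = only-i j (subst (NonFull d) (deg-other j a j≢i) nf)

        nonFull-at-w : ∀ j → NonFull d (deg (P' j) w) → j ≡ i
        nonFull-at-w j nf with j ≟ i
        ... | yes j≡i = j≡i
        ... | no  j≢i with subst (1 ≤_) (trans (deg-other j w j≢i) (deg-w j)) (proj₁ nf)
        ...   | ()

        oneNonFull' : ∀ v j j' → NonFull d (deg (P' j) v) → NonFull d (deg (P' j') v) → j ≡ j'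
        oneNonFull' v j j' nf nf' with v ≟ a | v ≟ w
        ... | yes refl | _        = trans (nonFull-at-a j nf) (sym (nonFull-at-a j' nf'))
        ... | no _     | yes refl = trans (nonFull-at-w j nf) (sym (nonFull-at-w j' nf'))
        ... | no v≢a   | no v≢w   = oneNonFull v j j' (subst (NonFull d) (deg-elsewhere j v v≢a v≢w) nf)
                                                      (subst (NonFull d) (deg-elsewhere j' v v≢a v≢w) nf')

        covers' : ∀ u v → adj u v ≡ true → add R w u ≡ true → add R w v ≡ true → ∃ λ j → P' j u v ≡ true
        covers' u v uv R'u R'v with new-edges u v uv R'u R'v
        ... | inj₁ (Ru , Rv) = let (j , Pj) = covers u v uv Ru Rv in j , grows j u v Pj
        ... | inj₂ e         = i , gets-edge u v e

        disjoint' : ∀ u v j j' → P' j u v ≡ true → P' j' u v ≡ true → j ≡ j'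
        disjoint' u v j j' P'j P'j' with P'-cases j u v P'j | P'-cases j' u v P'j'
        ... | inj₁ Pj        | inj₁ Pj'        = disjoint u v j j' Pj Pj'
        ... | inj₂ (j≡i , _) | inj₂ (j'≡i , _) = trans j≡i (sym j'≡i)
        ... | inj₁ Pj        | inj₂ (_ , e)    = ⊥-elim (true≢false (trans (sym Pj) (edge-new j u v e)))
        ... | inj₂ (_ , e)   | inj₁ Pj'        = ⊥-elim (true≢false (trans (sym Pj') (edge-new j' u v e)))

        inside' : ∀ j u v → P' j u v ≡ true → add R w u ≡ true
        inside' j u v P'j with P'-cases j u v P'j
        ... | inj₁ Pj       = add-old R w (inside j u v Pj)
        ... | inj₂ (_ , e)  = edge-in-R' u v e

        family' : Family (add R w) k P'
        family' = record
          { symm = on-piece (λ _ S → ∀ u v → S u v ≡ S v u) (+edge-sym (P i) (symm i)) (λ j _ → symm j)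
          ; irrefl = on-piece (λ _ S → ∀ v → S v v ≡ false) (+edge-irrefl (P i) (irrefl i)) (λ j _ → irrefl j)
          ; ⊆T = on-piece (λ _ S → ∀ u v → S u v ≡ true → adj u v ≡ true)
                          (+edge-⊆ (P i) adj (⊆T i) aw wa) (λ j _ → ⊆T j)
          ; conn = on-piece (λ _ S → ∀ u v → InV S u → InV S v → Walk S u v)
                            (+edge-connected (P i) (symm i) reach) (λ j _ → conn j)
          ; bounded = bounded' ; inside = inside' ; covers = covers' ; disjoint = disjoint' ; oneNonFull = oneNonFull' }

        nonempty' : (∀ j → j ≢ i → ∃ (InV (P j))) → ∀ j → ∃ (InV (P' j))
        nonempty' nonempty j with j ≟ i
        ... | yes refl = a , w , gets-edge a w edge-aw
        ... | no  j≢i  = let (u , x , Pj) = nonempty j j≢i in u , x , grows j u x Pj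

    extend : State R → State (add R w)
    extend (k , P , F , nonempty) with any? (λ i → NonFull? d (deg (P i) a))
    ... | yes (i , nf) = k , P' , family' , nonempty' (λ j _ → nonempty j)
      where
        only-i : ∀ j → NonFull d (deg (P j) a) → j ≡ i
        only-i j nfj = Family.oneNonFull F a j i nfj nf
        reach : ∀ u → InV (P i) u → Walk (P i) u a
        reach u u∈ = Family.conn F i u a u∈ (deg⇒InV (P i) a (proj₁ nf))
        open Extend F i (proj₂ nf) only-i reach
    ... | no none = suc k , P' , family' , nonempty' nonempty₀
      where
        room : deg emptyE a < d
        room = subst (_< d) (sym (deg-zero emptyE a (λ _ → refl))) (≤-trans (s≤s z≤n) 2≤d)
        only-0 : ∀ j → NonFull d (deg ((emptyE ◂ P) j) a) → j ≡ zero
        only-0 zero    _  = refl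
        only-0 (suc j) nf = ⊥-elim (none (j , nf))
        reach : ∀ u → InV emptyE u → Walk emptyE u a
        reach u (_ , ())
        nonempty₀ : ∀ j → j ≢ zero → ∃ (InV ((emptyE ◂ P) j))
        nonempty₀ zero    0≢0 = ⊥-elim (0≢0 refl)
        nonempty₀ (suc j) _   = nonempty j
        open Extend (prepend F) zero room only-0 reach

  -- The grown set is all of V(T) since T is connected; the final family is saturated.
  saturated : ∃ λ k → Σ (Fin k → EdgeSet n) (Saturated T d k)
  saturated with grow State State-single Step.extend
  ... | R , Rr , _ , closed , (k , P , F , nonempty) = k , P , record
        { partition = partition ; nonempty = nonempty ; oneNonFull = Family.oneNonFull F }
    where
      open Family F
      everywhere : ∀ x → R x ≡ true
      everywhere x = let (xs , walk) = connected r x in closed-walk R closed Rr (fromWalkFromTo xs walk)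
      partition : DegPartition T d k P
      partition = record
        { subtree = λ i → record
            { simple = symm i , irrefl i ; sub = ⊆T i
            ; connected = λ u v u∈ v∈ → verts (conn i u v u∈ v∈) , toWalkFromTo (conn i u v u∈ v∈)
            ; acyclic = acyclic-⊆ (⊆T i) acyclic }
        ; bounded = bounded ; cover = λ u v uv → covers u v uv (everywhere u) (everywhere v) ; unique = disjoint }

-- Local optimality: if a₀, …, a_{k-1} ≤ d and at most one of them is non-full, then all
-- positive aᵢ but at most one equal d, so  d · #{i : aᵢ > 0} + 1 ≤ Σ aᵢ + d.
full-or-zero : ∀ d x → x ≤ d → ¬ NonFull d x → d * sgn x ≤ x
full-or-zero d zero    _   _        = subst (_≤ 0) (sym (*-zeroʳ d)) z≤n
full-or-zero d (suc x) x≤d not-full =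
  subst (_≤ suc x) (sym (*-identityʳ d)) (≮⇒≥ (λ x<d → not-full (s≤s z≤n , x<d)))

nonFull-bound : ∀ d x → NonFull d x → d * sgn x + 1 ≤ x + d
nonFull-bound d x (1≤x , _) rewrite sgn-pos x 1≤x | *-identityʳ d = subst (_≤ x + d) (+-comm 1 d) (+-monoˡ-≤ d 1≤x)

saturated-count : ∀ d {k} (a : Fin k → ℕ) → 1 ≤ d → (∀ i → a i ≤ d) →
  (∀ i j → NonFull d (a i) → NonFull d (a j) → i ≡ j) → d * sum (sgn ∘ a) + 1 ≤ sum a + d
saturated-count d {zero}  a 1≤d _   _        = subst (λ x → x + 1 ≤ d) (sym (*-zeroʳ d)) 1≤d
saturated-count d {suc k} a 1≤d a≤d only-one with NonFull? d (a zero)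
... | yes nf₀ = begin
      d * (sgn (a zero) + S) + 1            ≡⟨ regroup d (sgn (a zero)) S ⟩
      (d * sgn (a zero) + 1) + d * S        ≤⟨ +-mono-≤ (nonFull-bound d (a zero) nf₀) rest-full ⟩
      (a zero + d) + Σa                     ≡⟨ solve 3 (λ x d y → (x :+ d) :+ y := x :+ y :+ d) refl (a zero) d Σa ⟩
      a zero + Σa + d                       ∎
  where
    open ≤-Reasoning
    S Σa : ℕ
    S  = sum (sgn ∘ a ∘ suc)
    Σa = sum (a ∘ suc)
    regroup : ∀ d x S → d * (x + S) + 1 ≡ (d * x + 1) + d * S
    regroup = solve 3 (λ d x S → d :* (x :+ S) :+ con 1 := (d :* x :+ con 1) :+ d :* S) refl
    rest-full : d * S ≤ Σa
    rest-full = subst (_≤ Σa) (sym (*-distribˡ-sum d (sgn ∘ a ∘ suc)))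
      (sum-mono λ i → full-or-zero d (a (suc i)) (a≤d (suc i)) (λ nf → 0≢suc (only-one zero (suc i) nf₀ nf)))
      where
        0≢suc : ∀ {i : Fin k} → zero ≢ suc i
        0≢suc ()
... | no not-full₀ = begin
      d * (sgn (a zero) + S) + 1            ≡⟨ regroup d (sgn (a zero)) S ⟩
      d * sgn (a zero) + (d * S + 1)        ≤⟨ +-mono-≤ (full-or-zero d (a zero) (a≤d zero) not-full₀)
                                                        (saturated-count d (a ∘ suc) 1≤d (a≤d ∘ suc)
                                                           (λ i j nfi nfj → suc-injective (only-one (suc i) (suc j) nfi nfj))) ⟩
      a zero + (Σa + d)                     ≡⟨ +-assoc (a zero) Σa d ⟨
      a zero + Σa + d                       ∎
  where
    open ≤-Reasoning
    S Σa : ℕ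
    S  = sum (sgn ∘ a ∘ suc)
    Σa = sum (a ∘ suc)
    regroup : ∀ d x S → d * (x + S) + 1 ≡ d * x + (d * S + 1)
    regroup = solve 3 (λ d x S → d :* (x :+ S) :+ con 1 := d :* x :+ (d :* S :+ con 1)) refl

fewest-pieces : ∀ d p q x → d * p + 1 ≤ x + d → x ≤ d * q → p ≤ q
fewest-pieces d p q x local x≤dq = ≤-pred (*-cancelˡ-< d p (suc q) (begin-strict
      d * p         <⟨ subst (d * p <_) (+-comm 1 (d * p)) ≤-refl ⟩
      d * p + 1     ≤⟨ local ⟩
      x + d         ≤⟨ +-monoˡ-≤ d x≤dq ⟩
      d * q + d     ≡⟨ solve 2 (λ d q → d :* q :+ d := d :* (con 1 :+ q)) refl d q ⟩
      d * suc q     ∎))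
  where open ≤-Reasoning

local-tight : ∀ d p x → 2 ≤ d → x ≤ d * p → d * p + 1 ≤ x + d → (d * p + 1 ≡ x + d ⇔ CongOneMod d x)
local-tight d p x 2≤d x≤dp local = mk⇔ (to p) from
  where
    to : ∀ p → d * p + 1 ≡ x + d → CongOneMod d x
    to zero    eq = ⊥-elim (<⇒≢ (≤-trans 2≤d (m≤n+m d x)) (trans (cong (_+ 1) (sym (*-zeroʳ d))) eq))
    to (suc q) eq = q , +-cancelʳ-≡ d x (1 + q * d)
                          (trans (sym eq) (solve 2 (λ d q → d :* (con 1 :+ q) :+ con 1 := con 1 :+ q :* d :+ d) refl d q))
    from : CongOneMod d x → d * p + 1 ≡ x + d
    from (q , refl) = ≤-antisym local (begin
        1 + q * d + d   ≡⟨ solve 2 (λ d q → con 1 :+ q :* d :+ d := d :* (con 1 :+ q) :+ con 1) refl d q ⟩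
        d * suc q + 1   ≤⟨ +-monoˡ-≤ 1 (*-monoʳ-≤ d q<p) ⟩
        d * p + 1       ∎)
      where
        open ≤-Reasoning
        q<p : q < p
        q<p = *-cancelˡ-< d q p (subst (_< d * p) (*-comm q d) x≤dp)

-- With N = 2 + m vertices, degree sum D = 2N - 2, k pieces and
-- S = Σ_v pieces(v) = D/2 + k, the local bounds summed over all vertices differ from the
-- global bound  d·k ≤ d + m  by the same slack.
slack-identity : ∀ d m k S D → 2 * S ≡ D + k * 2 → D + 2 ≡ 2 * (2 + m) →
  (d * S + (2 + m) * 1) + (d + m) ≡ (D + (2 + m) * d) + d * k
slack-identity d m k S D incidences edges = +-cancelʳ-≡ 2 _ _ (begin
    d * S + (2 + m) * 1 + (d + m) + 2
  ≡⟨ solve 3 (λ d m S → d :* S :+ (con 2 :+ m) :* con 1 :+ (d :+ m) :+ con 2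
                      := d :* (S :+ con 1) :+ con 2 :* (con 2 :+ m)) refl d m S ⟩
    d * (S + 1) + 2 * (2 + m)
  ≡⟨ cong₂ (λ s t → d * s + t) S+1 (sym edges) ⟩
    d * ((2 + m) + k) + (D + 2)
  ≡⟨ solve 4 (λ d m k D → d :* ((con 2 :+ m) :+ k) :+ (D :+ con 2)
                      := D :+ (con 2 :+ m) :* d :+ d :* k :+ con 2) refl d m k D ⟩
    D + (2 + m) * d + d * k + 2
  ∎)
  where
    open ≡-Reasoning
    S+1 : S + 1 ≡ (2 + m) + k
    S+1 = *-cancelˡ-≡ (S + 1) ((2 + m) + k) 2 (begin
        2 * (S + 1)         ≡⟨ *-distribˡ-+ 2 S 1 ⟩
        2 * S + 2           ≡⟨ cong (_+ 2) incidences ⟩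
        D + k * 2 + 2       ≡⟨ solve 2 (λ D k → D :+ k :* con 2 :+ con 2 := (D :+ con 2) :+ k :* con 2) refl D k ⟩
        (D + 2) + k * 2     ≡⟨ cong (_+ k * 2) edges ⟩
        2 * (2 + m) + k * 2 ≡⟨ solve 2 (λ m k → con 2 :* (con 2 :+ m) :+ k :* con 2
                                             := con 2 :* ((con 2 :+ m) :+ k)) refl m k ⟩
        2 * ((2 + m) + k)   ∎)

fewer-pieces : ∀ D k k' S S' → 2 * S ≡ D + k * 2 → 2 * S' ≤ D + k' * 2 → S ≤ S' → k ≤ k'
fewer-pieces D k k' S S' incidences incidences' S≤S' = *-cancelʳ-≤ k k' 2 (+-cancelˡ-≤ D _ _ (begin
    D + k * 2   ≡⟨ incidences ⟨
    2 * S       ≤⟨ *-monoʳ-≤ 2 S≤S' ⟩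
    2 * S'      ≤⟨ incidences' ⟩
    D + k' * 2  ∎))
  where open ≤-Reasoning

-- A tree on n ≥ 2 vertices has n - 1 edges: every vertex has a neighbour, so T spans
-- all n vertices, and `EdgeCount` applies.
tree-degSum : ∀ {m} (T : Tree (2 + m)) → degSum (Tree.adj T) + 2 ≡ 2 * (2 + m)
tree-degSum {m} T =
  trans (proj₂ (EdgeCount.edgeCount adj simple zero (has-nbr zero) (λ u v _ _ → walk u v)) acyclic)
        (cong (2 *_) spans-all)
  where
    open Tree T
    walk : ∀ u v → Walk adj u v
    walk u v = let (xs , w) = connected u v in fromWalkFromTo xs w
    has-nbr : ∀ v → InV adj v
    has-nbr zero    = start-InV (walk zero (suc zero)) (λ ())
    has-nbr (suc v) = start-InV (walk (suc v) zero) (λ ())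
    spans-all : order adj ≡ 2 + m
    spans-all = trans (sum-cong-≗ (λ v → sgn-pos _ (InV⇒deg adj v (has-nbr v))))
                      (trans (sum-const (2 + m) 1) (*-identityʳ (2 + m)))

module Optimal {m} (d : ℕ) (2≤d : 2 ≤ d) (T : Tree (2 + m)) {k} {P : Fin k → EdgeSet (2 + m)}
               (sat : Saturated T d k P) where
  open Saturated sat
  open Tree T using (adj)
  open PartitionCount T d k P partition

  local : ∀ v → d * pieces P v + 1 ≤ deg adj v + d
  local v = subst (λ x → d * pieces P v + 1 ≤ x + d) (sym (deg-split v))
    (saturated-count d (λ i → deg (P i) v) (≤-trans (s≤s z≤n) 2≤d)
                     (λ i → DegPartition.bounded partition i v) (λ i j → oneNonFull v i j))

  lhs rhs : ℕ
  lhs = sum (λ v → d * pieces P v + 1)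
  rhs = sum (λ v → deg adj v + d)

  slack : lhs + (d + m) ≡ rhs + d * k
  slack = begin
      lhs + (d + m)                                   ≡⟨ cong (_+ (d + m)) lhs≡ ⟩
      (d * sum (pieces P) + (2 + m) * 1) + (d + m)    ≡⟨ slack-identity d m k _ _ (pieces-≡ nonempty) (tree-degSum T) ⟩
      (degSum adj + (2 + m) * d) + d * k              ≡⟨ cong (_+ d * k) rhs≡ ⟨
      rhs + d * k                                     ∎
    where
      open ≡-Reasoning
      lhs≡ : lhs ≡ d * sum (pieces P) + (2 + m) * 1
      lhs≡ = trans (∑-distrib-+ {2 + m} (λ v → d * pieces P v) (λ _ → 1))
                   (cong₂ _+_ (sym (*-distribˡ-sum d (pieces P))) (sum-const (2 + m) 1))
      rhs≡ : rhs ≡ degSum adj + (2 + m) * d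
      rhs≡ = trans (∑-distrib-+ {2 + m} (deg adj) (λ _ → d)) (cong (degSum adj +_) (sum-const (2 + m) d))

  bound : d * k ≤ d + m
  bound = +-cancelˡ-≤ rhs _ _ (subst (_≤ rhs + (d + m)) slack (+-monoˡ-≤ (d + m) (sum-mono local)))

  -- at every vertex a saturated partition uses the fewest pieces, hence the fewest in total
  minimal : ∀ k' → HasDegPartition T d k' → k ≤ k'
  minimal k' (Q , Q-part) = fewer-pieces (degSum adj) k k' _ _ (pieces-≡ nonempty) Q.pieces-≤
    (sum-mono λ v → fewest-pieces d _ _ _ (local v) (Q.deg≤ v))
    where module Q = PartitionCount T d k' Q Q-part

  tight : d * k ≡ d + m ⇔ (∀ v → CongOneMod d (deg adj v))
  tight = mk⇔ to from
    where
      local-tight-at : ∀ v → d * pieces P v + 1 ≡ deg adj v + d ⇔ CongOneMod d (deg adj v)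
      local-tight-at v = local-tight d (pieces P v) (deg adj v) 2≤d (deg≤ v) (local v)
      to : d * k ≡ d + m → ∀ v → CongOneMod d (deg adj v)
      to eq v = Equivalence.to (local-tight-at v)
                  (sum-tight local (+-cancelʳ-≡ (d + m) lhs rhs (trans slack (cong (rhs +_) eq))) v)
      from : (∀ v → CongOneMod d (deg adj v)) → d * k ≡ d + m
      from all≡1 = +-cancelˡ-≡ rhs _ _ (trans (sym slack)
                     (cong (_+ (d + m)) (sum-cong-≗ λ v → Equivalence.from (local-tight-at v) (all≡1 v))))

mainTheorem3 : (d n : ℕ) → 2 ≤ d → 2 ≤ n → (T : Tree n) →
    ∃[ m ] (IsMinPartitionNumber T d m × d * m ≤ d + (n ∸ 2) ×
    ((d * m ≡ d + (n ∸ 2)) ⇔ (∀ (v : Fin n) → CongOneMod d (deg (Tree.adj T) v))))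
mainTheorem3 d (suc (suc m)) 2≤d (s≤s (s≤s z≤n)) T =
  let (k , P , sat) = Greedy.saturated T d 2≤d zero
      open Optimal d 2≤d T sat
  in k , ((P , Saturated.partition sat) , minimal) , bound , tight
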